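{- For every undirected tree $U$, $\mathrm{contr}(U)=\mathrm{erank}(U)$.
   Context: Matching game: for an undirected tree $U$, set $T_1=U$; at step $i$ one chooses a matching $M_i$ in $T_i$ and contracts all edges of $M_i$ to obtain the tree $T_{i+1}$; the game ends when the current tree is a single vertex. The contraction number $\mathrm{contr}(U)$ is the minimum number of matchings in such a sequence needed to contract $U$ to a single vertex. An edge rank coloring of $U$ with $k$ colors assigns to each edge a color in $\{1,\dots,k\}$ such that whenever two distinct edges have the same color $i$, the path in $U$ between these two edges contains an edge with some color $j>i$; $\mathrm{erank}(U)$ is the minimum such $k$ ($0$ if $U$ has no edges). -}

module Defs where

open import Data.Nat using (ℕ; zero; suc; _≤_; _<_)
open import Data.Fin using (Fin; toℕ)
open import Data.Bool using (Bool; true)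
open import Data.List using (List; []; _∷_; _++_; [_]; head; last; length)
open import Data.List.Relation.Unary.Unique.Propositional using (Unique)
open import Data.Maybe using (just)
open import Data.Product using (Σ; ∃; ∃-syntax; _×_; _,_)
open import Data.Sum using (_⊎_)
open import Relation.Nullary using (¬_)
open import Relation.Binary.PropositionalEquality using (_≡_; _≢_)
open import Function.Bundles using (_⇔_)

record Graph (n : ℕ) : Set where
  field
    Adj   : Fin n → Fin n → Bool
    sym   : ∀ x y → Adj x y ≡ Adj y x
    irrefl : ∀ x → ¬ (Adj x x ≡ true)
open Graph public

-- An edge {u,v}, stored canonically with toℕ u < toℕ v.
record Edge {n : ℕ} (G : Graph n) : Set where
  constructor edge
  field
    u   : Fin n
    v   : Fin n
    u<v : toℕ u < toℕ v
    adj : Adj G u v ≡ true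
open Edge public

SameEdge : ∀ {n} {G : Graph n} → Edge G → Edge G → Set
SameEdge e e' = u e ≡ u e' × v e ≡ v e'

data Consec {A : Set} (x y : A) : List A → Set where
  here  : ∀ {xs} → Consec x y (x ∷ y ∷ xs)
  there : ∀ {z xs} → Consec x y xs → Consec x y (z ∷ xs)

IsWalk : ∀ {n} → Graph n → List (Fin n) → Set
IsWalk G p = ∀ x y → Consec x y p → Adj G x y ≡ true

IsPath : ∀ {n} → Graph n → List (Fin n) → Set
IsPath G p = IsWalk G p × Unique p

EdgeOn : ∀ {n} {G : Graph n} → Edge G → List (Fin n) → Set
EdgeOn e p = Consec (u e) (v e) p ⊎ Consec (v e) (u e) p

Connected : ∀ {n} → Graph n → Set
Connected {n} G = ∀ (x y : Fin n) → ∃[ p ] (IsWalk G p × head p ≡ just x × last p ≡ just y)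

HasCycle : ∀ {n} → Graph n → Set
HasCycle {n} G = ∃[ x ] ∃[ xs ] (2 ≤ length xs × Unique (x ∷ xs) × IsWalk G (x ∷ xs ++ [ x ]))

IsTree : ∀ {n} → Graph n → Set
IsTree {n} G = 1 ≤ n × Connected G × ¬ HasCycle G

IsMatching : ∀ {n} (G : Graph n) → (Edge G → Bool) → Set
IsMatching G M = ∀ e e' → M e ≡ true → M e' ≡ true → ¬ SameEdge e e' →
  (u e ≢ u e') × (u e ≢ v e') × (v e ≢ u e') × (v e ≢ v e')

MatchedPair : ∀ {n} {G : Graph n} → (Edge G → Bool) → Fin n → Fin n → Set
MatchedPair M x y = ∃[ e ] (M e ≡ true × ((u e ≡ x × v e ≡ y) ⊎ (u e ≡ y × v e ≡ x)))

-- G' is (up to isomorphism) the graph obtained from G by contracting the edges of M,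
-- witnessed by the quotient map f.
IsContraction : ∀ {n n'} (G : Graph n) → (Edge G → Bool) → Graph n' → Set
IsContraction {n} {n'} G M G' = Σ (Fin n → Fin n') λ f →
  (∀ a → ∃[ x ] (f x ≡ a)) ×
  (∀ x y → (f x ≡ f y) ⇔ (x ≡ y ⊎ MatchedPair M x y)) ×
  (∀ a b → (Adj G' a b ≡ true) ⇔ (a ≢ b × ∃[ x ] ∃[ y ] (f x ≡ a × f y ≡ b × Adj G x y ≡ true)))

data ContractsIn : ∀ {n} → Graph n → ℕ → Set where
  done : ∀ {n} {G : Graph n} → n ≡ 1 → ContractsIn G zero
  step : ∀ {n n' k} {G : Graph n} (M : Edge G → Bool) (G' : Graph n') →
         IsMatching G M → IsContraction G M G' → ContractsIn G' k → ContractsIn G (suc k)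

IsContr : ∀ {n} → Graph n → ℕ → Set
IsContr G m = ContractsIn G m × (∀ k → ContractsIn G k → m ≤ k)

-- Edge rank colouring with k colours (colours Fin k ≅ {1..k}, order via toℕ)
IsRankColoring : ∀ {n} (G : Graph n) (k : ℕ) → (Edge G → Fin k) → Set
IsRankColoring {n} G k c = ∀ e e' → ¬ SameEdge e e' → c e ≡ c e' →
  ∀ (p : List (Fin n)) → IsPath G p → EdgeOn e p → EdgeOn e' p →
  ∃[ f ] (EdgeOn f p × toℕ (c e) < toℕ (c f))

RankColorable : ∀ {n} → Graph n → ℕ → Set
RankColorable G k = Σ (Edge G → Fin k) (IsRankColoring G k)

IsErank : ∀ {n} → Graph n → ℕ → Set
IsErank G m = RankColorable G m × (∀ k → RankColorable G k → m ≤ k)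

-- Both directions go through one contraction step. If M is a matching of a forest G and G' the
-- contracted forest, a rank coloring c' of G' with k colors gives one of G with k + 1 colors: color
-- the edges of M with 0 and every other edge with 1 + c' of its image. Two distinct edges of equal
-- positive color on a path of G have distinct images on the image path, and the edge of larger
-- color found there lifts back; two edges of M on a path are separated by an edge not in M.
-- Conversely, in a rank coloring of a tree the edges of color 0 form a matching (on a path x y z
-- through two of them no edge has larger color), and after contracting it every other color drops
-- by one, since paths of the contracted tree lift to paths of the tree. Hence a tree is contracted
-- by k matchings iff it has a rank coloring with k colors, and the least such k exists because rank
-- colorability is decidable and n² colors always suffice.

module Submission where

open import Defs
open import Axiom.UniquenessOfIdentityProofs using (module Decidable⇒UIP)
open import Data.Bool using (Bool; true; false)
import Data.Bool.Properties as Boolₚ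
open import Data.Empty using (⊥; ⊥-elim)
open import Data.Fin as Fin using (Fin; toℕ; _≟_)
import Data.Fin.Properties as Finₚ
open import Data.List using (List; []; _∷_; _++_; [_]; head; last; length; lookup)
open import Data.List.Properties using (length-++-≤ʳ; ++-assoc)
open import Data.List.Membership.Propositional using (_∈_; _∉_)
open import Data.List.Membership.Propositional.Properties using (∈-∃++; ∈-lookup)
open import Data.List.Relation.Unary.All as All using (All; []; _∷_)
import Data.List.Relation.Unary.All.Properties as Allₚ
open import Data.List.Relation.Unary.AllPairs using ([]; _∷_)
open import Data.List.Relation.Unary.Any using (here; there)
open import Data.List.Relation.Unary.Unique.Propositional using (Unique)
open import Data.List.Relation.Unary.Unique.Propositional.Properties using (Unique[x∷xs]⇒x∉xs)
open import Data.Maybe using (just)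
open import Data.Maybe.Properties using (just-injective)
open import Data.Nat using (ℕ; zero; suc; _≤_; _<_; z≤n; s≤s; _*_; >-nonZero⁻¹)
import Data.Nat.Properties as ℕₚ
open import Data.Product using (Σ; ∃; ∃-syntax; _×_; _,_; proj₁; proj₂)
open import Data.Sum using (_⊎_; inj₁; inj₂)
import Data.Sum as Sum
open import Data.Unit using (⊤; tt)
open import Function using (_∘_)
open import Function.Bundles using (_⇔_; mk⇔; Equivalence)
open import Relation.Binary using (tri<; tri≈; tri>)
open import Relation.Binary.Structures using (IsDecEquivalence)
open import Relation.Binary.PropositionalEquality as ≡ using (_≡_; _≢_; refl; trans; cong; subst; subst₂)
open import Relation.Nullary using (¬_; Dec; yes; no; does)
open import Relation.Nullary.Decidable
  using (_×-dec_; _⊎-dec_; _→-dec_; ¬?; map′; decidable-stable; does-⇔; dec-true)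

private
  variable
    A B : Set
    a b c d w x y z : A

module _ {A : Set} where

  consec-++ˡ : ∀ {x y : A} xs ys → Consec x y xs → Consec x y (xs ++ ys)
  consec-++ˡ (_ ∷ _ ∷ _) ys here      = here
  consec-++ˡ (_ ∷ xs)    ys (there c) = there (consec-++ˡ xs ys c)

  lastOf : A → List A → A
  lastOf x []      = x
  lastOf x (y ∷ r) = lastOf y r

  last-∷ : ∀ (x : A) r → last (x ∷ r) ≡ just (lastOf x r)
  last-∷ x []      = refl
  last-∷ x (y ∷ r) = last-∷ y r

  lastOf-∷ʳ : ∀ (x : A) r z → lastOf x (r ++ [ z ]) ≡ z
  lastOf-∷ʳ x []      z = refl
  lastOf-∷ʳ x (y ∷ r) z = lastOf-∷ʳ y r z

  consec-∷ʳ⁻ : ∀ {a b : A} x xs {w} → Consec a b (x ∷ xs ++ [ w ]) →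
               Consec a b (x ∷ xs) ⊎ (a ≡ lastOf x xs × b ≡ w)
  consec-∷ʳ⁻ x []       here               = inj₂ (refl , refl)
  consec-∷ʳ⁻ x []       (there (there ()))
  consec-∷ʳ⁻ x (y ∷ xs) here               = inj₁ here
  consec-∷ʳ⁻ x (y ∷ xs) (there c)          = Sum.map₁ there (consec-∷ʳ⁻ y xs c)

  consec-lastOf : ∀ (x : A) xs w → Consec (lastOf x xs) w (x ∷ xs ++ [ w ])
  consec-lastOf x []       w = here
  consec-lastOf x (y ∷ xs) w = there (consec-lastOf y xs w)

  consec-∷⁻ : ∀ {a b : A} {w z L L'} → L' ≡ z ∷ L → Consec a b (w ∷ L') →
              (a ≡ w × b ≡ z) ⊎ Consec a b L'
  consec-∷⁻ refl here      = inj₁ (refl , refl)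
  consec-∷⁻ refl (there c) = inj₂ c

  unique-∷ : ∀ {x : A} {r} → x ∉ r → Unique r → Unique (x ∷ r)
  unique-∷ {r = r} x∉r u = Allₚ.¬Any⇒All¬ r x∉r ∷ u

  unique-++⁻ˡ : ∀ (xs : List A) {ys} → Unique (xs ++ ys) → Unique xs
  unique-++⁻ˡ []       _        = []
  unique-++⁻ˡ (x ∷ xs) (px ∷ u) = Allₚ.++⁻ˡ xs px ∷ unique-++⁻ˡ xs u

-- Edges, paths and cycles

SamePair : A → A → A → A → Set
SamePair a b c d = (a ≡ c × b ≡ d) ⊎ (a ≡ d × b ≡ c)

samePair-refl : SamePair a b a b
samePair-refl = inj₁ (refl , refl)

samePair-swap : SamePair a b b a
samePair-swap = inj₂ (refl , refl)

samePair-sym : SamePair a b c d → SamePair c d a b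
samePair-sym (inj₁ (refl , refl)) = samePair-refl
samePair-sym (inj₂ (refl , refl)) = samePair-swap

samePair-trans : SamePair a b c d → SamePair c d x y → SamePair a b x y
samePair-trans (inj₁ (refl , refl)) q                    = q
samePair-trans (inj₂ (refl , refl)) (inj₁ (refl , refl)) = samePair-swap
samePair-trans (inj₂ (refl , refl)) (inj₂ (refl , refl)) = samePair-refl

samePair-map : (g : A → B) → SamePair a b c d → SamePair (g a) (g b) (g c) (g d)
samePair-map g (inj₁ (refl , refl)) = samePair-refl
samePair-map g (inj₂ (refl , refl)) = samePair-swap

samePair-≡ : SamePair a b c d → c ≡ d → a ≡ b
samePair-≡ (inj₁ (refl , refl)) c≡d = c≡d
samePair-≡ (inj₂ (refl , refl)) c≡d = ≡.sym c≡d

samePair-shared : SamePair a b x y → SamePair a b y z → x ≡ z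
samePair-shared (inj₁ (refl , refl)) (inj₁ (refl , refl)) = refl
samePair-shared (inj₁ (refl , refl)) (inj₂ (refl , refl)) = refl
samePair-shared (inj₂ (refl , refl)) (inj₁ (refl , refl)) = refl
samePair-shared (inj₂ (refl , refl)) (inj₂ (refl , refl)) = refl

Joins : ∀ {n} {G : Graph n} → Edge G → Fin n → Fin n → Set
Joins e = SamePair (u e) (v e)

module _ {n : ℕ} (G : Graph n) where

  adj-≢ : Adj G x y ≡ true → x ≢ y
  adj-≢ {x} h refl = irrefl G x h

  adj-sym : Adj G x y ≡ true → Adj G y x ≡ true
  adj-sym {x} {y} h = trans (sym G y x) h

  joins-adj : ∀ (e : Edge G) → Joins e x y → Adj G x y ≡ true
  joins-adj e (inj₁ (refl , refl)) = adj e
  joins-adj e (inj₂ (refl , refl)) = adj-sym (adj e)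

  sameEdge⇒≡ : {e e' : Edge G} → SameEdge e e' → e ≡ e'
  sameEdge⇒≡ {edge a b p h} {edge .a .b p' h'} (refl , refl)
    with refl ← ℕₚ.<-irrelevant p p' | refl ← Decidable⇒UIP.≡-irrelevant Boolₚ._≟_ h h' = refl

  ≡⇒sameEdge : {e e' : Edge G} → e ≡ e' → SameEdge e e'
  ≡⇒sameEdge refl = refl , refl

  joins⇒≡ : ∀ (e e' : Edge G) → Joins e (u e') (v e') → e ≡ e'
  joins⇒≡ e e' (inj₁ same)   = sameEdge⇒≡ same
  joins⇒≡ e e' (inj₂ (p , q)) =
    ⊥-elim (ℕₚ.<-asym (u<v e) (subst₂ _<_ (cong toℕ (≡.sym q)) (cong toℕ (≡.sym p)) (u<v e')))

  joins-unique : ∀ (e e' : Edge G) → Joins e x y → Joins e' x y → e ≡ e'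
  joins-unique e e' j j' = joins⇒≡ e e' (samePair-trans j (samePair-sym j'))

  toEdge : ∀ x y → Adj G x y ≡ true → Edge G
  toEdge x y h with ℕₚ.<-cmp (toℕ x) (toℕ y)
  ... | tri< x<y _ _ = edge x y x<y h
  ... | tri≈ _ x≡y _ = ⊥-elim (adj-≢ h (Finₚ.toℕ-injective x≡y))
  ... | tri> _ _ y<x = edge y x y<x (adj-sym h)

  toEdge-joins : ∀ x y (h : Adj G x y ≡ true) → Joins (toEdge x y h) x y
  toEdge-joins x y h with ℕₚ.<-cmp (toℕ x) (toℕ y)
  ... | tri< _ _ _   = samePair-refl
  ... | tri≈ _ x≡y _ = ⊥-elim (adj-≢ h (Finₚ.toℕ-injective x≡y))
  ... | tri> _ _ _   = samePair-swap

  joins-on : ∀ (e : Edge G) p → Joins e x y → Consec x y p → EdgeOn e p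
  joins-on e p (inj₁ (refl , refl)) c = inj₁ c
  joins-on e p (inj₂ (refl , refl)) c = inj₂ c

  on-joins : ∀ (e : Edge G) p → EdgeOn e p → ∃[ x ] ∃[ y ] (Consec x y p × Joins e x y)
  on-joins e p (inj₁ c) = _ , _ , c , samePair-refl
  on-joins e p (inj₂ c) = _ , _ , c , samePair-swap

  toEdge-on : ∀ p (c : Consec x y p) (h : Adj G x y ≡ true) → EdgeOn (toEdge x y h) p
  toEdge-on {x} {y} p c h = joins-on (toEdge x y h) p (toEdge-joins x y h) c

  walk-[-] : ∀ x → IsWalk G [ x ]
  walk-[-] x _ _ (there ())

  walk-∷ : ∀ {r} → Adj G x y ≡ true → IsWalk G (y ∷ r) → IsWalk G (x ∷ y ∷ r)
  walk-∷ h w _ _ here      = h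
  walk-∷ h w a b (there c) = w a b c

  walk-head : ∀ {r} → IsWalk G (x ∷ y ∷ r) → Adj G x y ≡ true
  walk-head w = w _ _ here

  walk-tail : ∀ {r} → IsWalk G (x ∷ r) → IsWalk G r
  walk-tail w a b c = w a b (there c)

  walk-++⁻ˡ : ∀ xs ys → IsWalk G (xs ++ ys) → IsWalk G xs
  walk-++⁻ˡ xs ys w a b c = w a b (consec-++ˡ xs ys c)

  closed-path⇒cycle : ∀ x xs → IsPath G (x ∷ xs) → 2 ≤ length xs →
                      Adj G (lastOf x xs) x ≡ true → HasCycle G
  closed-path⇒cycle x xs (w , unique) len closing = x , xs , len , unique , closed
    where
    closed : IsWalk G (x ∷ xs ++ [ x ])
    closed a b c with consec-∷ʳ⁻ x xs c
    ... | inj₁ c'            = w a b c'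
    ... | inj₂ (refl , refl) = closing

  chord⇒cycle : ∀ {r} → IsPath G (x ∷ y ∷ r) → z ∈ r → Adj G x z ≡ true → HasCycle G
  chord⇒cycle {x} {y} {z} (w , unique) z∈r h with r₁ , r₂ , refl ← ∈-∃++ z∈r =
    closed-path⇒cycle x (y ∷ r₁ ++ [ z ])
      (walk-++⁻ˡ prefix r₂ (subst (IsWalk G) split w) , unique-++⁻ˡ prefix (subst Unique split unique))
      (s≤s (length-++-≤ʳ [ z ] {r₁}))
      (subst (λ t → Adj G t x ≡ true) (≡.sym (lastOf-∷ʳ y r₁ z)) (adj-sym h))
    where
    prefix = x ∷ y ∷ r₁ ++ [ z ]
    split : x ∷ y ∷ r₁ ++ z ∷ r₂ ≡ prefix ++ r₂
    split = cong (λ t → x ∷ y ∷ t) (≡.sym (++-assoc r₁ [ z ] r₂))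

  triangle⇒cycle : Adj G x y ≡ true → Adj G y z ≡ true → Adj G z x ≡ true → x ≢ z → HasCycle G
  triangle⇒cycle h₁ h₂ h₃ x≢z =
    closed-path⇒cycle _ (_ ∷ _ ∷ [])
      (walk-∷ h₁ (walk-∷ h₂ (walk-[-] _)) ,
       (adj-≢ h₁ ∷ x≢z ∷ []) ∷ (adj-≢ h₂ ∷ []) ∷ [] ∷ [])
      (s≤s (s≤s z≤n)) h₃

  square⇒cycle : Adj G w x ≡ true → Adj G x y ≡ true → Adj G y z ≡ true → Adj G z w ≡ true →
                 w ≢ y → x ≢ z → HasCycle G
  square⇒cycle h₁ h₂ h₃ h₄ w≢y x≢z =
    closed-path⇒cycle _ (_ ∷ _ ∷ _ ∷ [])
      (walk-∷ h₁ (walk-∷ h₂ (walk-∷ h₃ (walk-[-] _))) ,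
       (adj-≢ h₁ ∷ w≢y ∷ adj-≢ (adj-sym h₄) ∷ []) ∷ (adj-≢ h₂ ∷ x≢z ∷ []) ∷
       (adj-≢ h₃ ∷ []) ∷ [] ∷ [])
      (s≤s (s≤s z≤n)) h₄

  meet-free⇒matching : ∀ {M} →
    (∀ {e e' x y z} → M e ≡ true → M e' ≡ true → Joins e x y → Joins e' y z → x ≢ z → ⊥) →
    IsMatching G M
  meet-free⇒matching free e e' m m' ¬same = uu , uv , vu , vv
    where
    meet : Joins e x y → Joins e' y z → ⊥
    meet j j' = free m m' j j' λ { refl →
      ¬same (≡⇒sameEdge (joins-unique e e' j (samePair-trans j' samePair-swap))) }
    uu : u e ≢ u e'
    uu q = meet samePair-swap (inj₁ (≡.sym q , refl))
    uv : u e ≢ v e'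
    uv q = meet samePair-swap (inj₂ (refl , ≡.sym q))
    vu : v e ≢ u e'
    vu q = meet samePair-refl (inj₁ (≡.sym q , refl))
    vv : v e ≢ v e'
    vv q = meet samePair-refl (inj₂ (refl , ≡.sym q))

  matched-meet⇒≡ : ∀ {M} → IsMatching G M → ∀ {e e'} → M e ≡ true → M e' ≡ true →
                   Joins e x y → Joins e' y z → e ≡ e'
  matched-meet⇒≡ matching {e} {e'} m m' j j' with (u e ≟ u e') ×-dec (v e ≟ v e')
  ... | yes same = sameEdge⇒≡ same
  ... | no ¬same with uu , uv , vu , vv ← matching e e' m m' ¬same = ⊥-elim (disjoint j j')
    where
    disjoint : Joins e x y → Joins e' y z → ⊥
    disjoint (inj₁ (_ , p)) (inj₁ (q , _)) = vu (trans p (≡.sym q))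
    disjoint (inj₁ (_ , p)) (inj₂ (_ , q)) = vv (trans p (≡.sym q))
    disjoint (inj₂ (p , _)) (inj₁ (q , _)) = uu (trans p (≡.sym q))
    disjoint (inj₂ (p , _)) (inj₂ (_ , q)) = uv (trans p (≡.sym q))

-- Contractions of forests

module Contraction {n n'} {G : Graph n} (M : Edge G → Bool) (G' : Graph n')
                   (contraction : IsContraction G M G') where

  π : Fin n → Fin n'
  π = proj₁ contraction

  π-surjective : ∀ a → ∃[ x ] (π x ≡ a)
  π-surjective = proj₁ (proj₂ contraction)

  private
    fibres : ∀ x y → (π x ≡ π y) ⇔ (x ≡ y ⊎ MatchedPair M x y)
    fibres = proj₁ (proj₂ (proj₂ contraction))

    adjacency : ∀ a b → (Adj G' a b ≡ true) ⇔
                (a ≢ b × ∃[ x ] ∃[ y ] (π x ≡ a × π y ≡ b × Adj G x y ≡ true))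
    adjacency = proj₂ (proj₂ (proj₂ contraction))

  π-identifies : π x ≡ π y → x ≡ y ⊎ Adj G x y ≡ true
  π-identifies {x} {y} eq with Equivalence.to (fibres x y) eq
  ... | inj₁ x≡y         = inj₁ x≡y
  ... | inj₂ (e , _ , j) = inj₂ (joins-adj G e j)

  π-collapses⇒matched : ∀ e → π (u e) ≡ π (v e) → M e ≡ true
  π-collapses⇒matched e eq with Equivalence.to (fibres (u e) (v e)) eq
  ... | inj₁ u≡v          = ⊥-elim (adj-≢ G (adj e) u≡v)
  ... | inj₂ (e' , m , j) = subst (λ t → M t ≡ true) (joins⇒≡ G e' e j) m

  matched⇒π-collapses : ∀ e → M e ≡ true → π (u e) ≡ π (v e)
  matched⇒π-collapses e m = Equivalence.from (fibres (u e) (v e)) (inj₂ (e , m , samePair-refl))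

  unmatched⇒π-separates : ∀ e → M e ≡ false → π (u e) ≢ π (v e)
  unmatched⇒π-separates e ¬m eq with () ← trans (≡.sym (π-collapses⇒matched e eq)) ¬m

  π-adj : Adj G x y ≡ true → π x ≢ π y → Adj G' (π x) (π y) ≡ true
  π-adj {x} {y} h ne = Equivalence.from (adjacency (π x) (π y)) (ne , x , y , refl , refl , h)

  π-adj⁻ : ∀ {a b} → Adj G' a b ≡ true →
           a ≢ b × ∃[ x ] ∃[ y ] (π x ≡ a × π y ≡ b × Adj G x y ≡ true)
  π-adj⁻ {a} {b} = Equivalence.to (adjacency a b)

  module _ (acyclic : ¬ HasCycle G) where

    -- Two edges of a forest with the same image would close a triangle or a square.
    π-injective-on-adj : ∀ {x' y'} → Adj G x y ≡ true → Adj G x' y' ≡ true →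
                         π x ≡ π x' → π y ≡ π y' → π x ≢ π y → x ≡ x' × y ≡ y'
    π-injective-on-adj {x} {y} {x'} {y'} h h' ex ey ne with π-identifies ex | π-identifies ey
    ... | inj₁ x≡x'  | inj₁ y≡y' = x≡x' , y≡y'
    ... | inj₁ refl | inj₂ hy =
      ⊥-elim (acyclic (triangle⇒cycle G h hy (adj-sym G h')
                        (λ x≡y' → ne (trans (cong π x≡y') (≡.sym ey)))))
    ... | inj₂ hx   | inj₁ refl =
      ⊥-elim (acyclic (triangle⇒cycle G (adj-sym G hx) h (adj-sym G h')
                        (λ x'≡y → ne (trans ex (cong π x'≡y)))))
    ... | inj₂ hx   | inj₂ hy =
      ⊥-elim (acyclic (square⇒cycle G h hy (adj-sym G h') (adj-sym G hx)
                        (λ x≡y' → ne (trans (cong π x≡y') (≡.sym ey)))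
                        (λ y≡x' → ne (trans ex (cong π (≡.sym y≡x'))))))

    π-injective-on-edges : ∀ (e₁ e₂ : Edge G) → π (u e₁) ≢ π (v e₁) →
                       SamePair (π (u e₁)) (π (v e₁)) (π (u e₂)) (π (v e₂)) → e₁ ≡ e₂
    π-injective-on-edges e₁ e₂ ne (inj₁ (p , q)) =
      joins⇒≡ G e₁ e₂ (inj₁ (π-injective-on-adj (adj e₁) (adj e₂) p q ne))
    π-injective-on-edges e₁ e₂ ne (inj₂ (p , q)) =
      joins⇒≡ G e₁ e₂ (inj₂ (π-injective-on-adj (adj e₁) (adj-sym G (adj e₂)) p q ne))

  -- The image of the walk x ∷ r, with the repetitions caused by contracted edges removed.
  image : Fin n → List (Fin n) → List (Fin n')
  image x []      = [ π x ]
  image x (y ∷ r) with π x ≟ π y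
  ... | yes _ = image y r
  ... | no  _ = π x ∷ image y r

  image-∷ : ∀ x r → ∃[ L ] (image x r ≡ π x ∷ L)
  image-∷ x []      = [] , refl
  image-∷ x (y ∷ r) with π x ≟ π y
  ... | no  _    = image y r , refl
  ... | yes πx≡πy with L , eq ← image-∷ y r = L , trans eq (cong (_∷ L) (≡.sym πx≡πy))

  image-head : ∀ x r → head (image x r) ≡ just (π x)
  image-head x r = cong head (proj₂ (image-∷ x r))

  image-last : ∀ x r → last (image x r) ≡ just (π (lastOf x r))
  image-last x []      = refl
  image-last x (y ∷ r) with π x ≟ π y
  ... | yes _ = image-last y r
  ... | no  _ with image-∷ y r | image-last y r
  ...   | L , eq | ih rewrite eq = ih

  image-∈ : ∀ {a} x r → a ∈ image x r → ∃[ z ] (z ∈ (x ∷ r) × π z ≡ a)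
  image-∈ x []      (here refl) = x , here refl , refl
  image-∈ x (y ∷ r) a∈          with π x ≟ π y
  image-∈ x (y ∷ r) a∈          | yes _ with z , z∈ , eq ← image-∈ y r a∈  = z , there z∈ , eq
  image-∈ x (y ∷ r) (here refl) | no  _ = x , here refl , refl
  image-∈ x (y ∷ r) (there a∈)  | no  _ with z , z∈ , eq ← image-∈ y r a∈ = z , there z∈ , eq

  consec-image⁻ : ∀ {a b} x r → Consec a b (image x r) →
                  ∃[ x' ] ∃[ y' ] (Consec x' y' (x ∷ r) × π x' ≡ a × π y' ≡ b × π x' ≢ π y')
  consec-image⁻ x []      (there ())
  consec-image⁻ x (y ∷ r) c with π x ≟ π y
  ... | yes _ with x' , y' , c' , rest ← consec-image⁻ y r c = x' , y' , there c' , rest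
  ... | no πx≢πy with L , eq ← image-∷ y r with consec-∷⁻ eq c
  ...   | inj₁ (refl , refl) = x , y , here , refl , refl , πx≢πy
  ...   | inj₂ c' with x' , y' , c'' , rest ← consec-image⁻ y r c' = x' , y' , there c'' , rest

  consec-image : ∀ x r → Consec a b (x ∷ r) → π a ≢ π b → Consec (π a) (π b) (image x r)
  consec-image x (y ∷ r) here ne with π x ≟ π y
  ... | yes πx≡πy = ⊥-elim (ne πx≡πy)
  ... | no  _ with L , eq ← image-∷ y r rewrite eq = here
  consec-image x (y ∷ r) (there c) ne with π x ≟ π y
  ... | yes _ = consec-image y r c ne
  ... | no  _ = there (consec-image y r c ne)

  image-walk : ∀ x r → IsWalk G (x ∷ r) → IsWalk G' (image x r)
  image-walk x r w a b c with x' , y' , c' , refl , refl , ne ← consec-image⁻ x r c = π-adj (w x' y' c') ne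

  image-path : ¬ HasCycle G → ∀ x r → IsPath G (x ∷ r) → IsPath G' (image x r)
  image-path acyclic x r path = image-walk x r (proj₁ path) , unique x r path
    where
    -- A repeated class along a path of a forest would give a chord.
    fresh : ∀ x y r → IsPath G (x ∷ y ∷ r) → π x ≢ π y → π x ∉ image y r
    fresh x y r (w , uniq) ne πx∈ with image-∈ y r πx∈
    ... | z , here refl , eq = ne (≡.sym eq)
    ... | z , there z∈r , eq with π-identifies (≡.sym eq)
    ...   | inj₁ refl = Unique[x∷xs]⇒x∉xs uniq (there z∈r)
    ...   | inj₂ h    = acyclic (chord⇒cycle G (w , uniq) z∈r h)

    unique : ∀ x r → IsPath G (x ∷ r) → Unique (image x r)
    unique x []      _ = [] ∷ []
    unique x (y ∷ r) (w , uniq@(_ ∷ uniq')) with π x ≟ π y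
    ... | yes _ = unique y r (walk-tail G w , uniq')
    ... | no ne = unique-∷ (fresh x y r (w , uniq) ne) (unique y r (walk-tail G w , uniq'))

  record Lift (a : Fin n') (r : List (Fin n')) (x y : Fin n) : Set where
    field
      tail    : List (Fin n)
      walk    : IsWalk G (x ∷ tail)
      ends    : lastOf x tail ≡ y
      into    : ∀ z → z ∈ (x ∷ tail) → π z ∈ (a ∷ r)
      unique  : Unique (a ∷ r) → Unique (x ∷ tail)
      consec⁺ : ∀ p q → Consec p q (x ∷ tail) → π p ≢ π q → Consec (π p) (π q) (a ∷ r)
      consec⁻ : ∀ b c → Consec b c (a ∷ r) →
                ∃[ p ] ∃[ q ] (Consec p q (x ∷ tail) × π p ≡ b × π q ≡ c)
      longer  : length r ≤ length tail

  lift-[] : ∀ {a} x y → π x ≡ a → π y ≡ a → Lift a [] x y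
  lift-[] x y πx πy with x ≟ y
  ... | yes refl = record
    { tail = [] ; walk = walk-[-] G x ; ends = refl
    ; into = λ { _ (here refl) → here πx }
    ; unique = λ _ → [] ∷ []
    ; consec⁺ = λ _ _ → λ { (there ()) }
    ; consec⁻ = λ _ _ → λ { (there ()) }
    ; longer = z≤n }
  ... | no x≢y with π-identifies (trans πx (≡.sym πy))
  ...   | inj₁ x≡y = ⊥-elim (x≢y x≡y)
  ...   | inj₂ h   = record
    { tail = [ y ] ; walk = walk-∷ G h (walk-[-] G y) ; ends = refl
    ; into = λ { _ (here refl) → here πx ; _ (there (here refl)) → here πy }
    ; unique = λ _ → (x≢y ∷ []) ∷ [] ∷ []
    ; consec⁺ = λ { _ _ here ne → ⊥-elim (ne (trans πx (≡.sym πy))) ; _ _ (there (there ())) _ }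
    ; consec⁻ = λ _ _ → λ { (there ()) }
    ; longer = z≤n }

  lift-∷-new : ∀ {a b r p q y} → Adj G p q ≡ true → π p ≡ a → π q ≡ b →
               Lift b r q y → Lift a (b ∷ r) p y
  lift-∷-new {a} {b} {r} {p} {q} h πp πq R = record
    { tail = q ∷ tail ; walk = walk-∷ G h walk ; ends = ends
    ; into = λ { _ (here refl) → here πp ; z (there z∈) → there (into z z∈) }
    ; unique = λ { uniq@(_ ∷ uniq') →
        unique-∷ (λ p∈ → Unique[x∷xs]⇒x∉xs uniq (subst (_∈ (b ∷ r)) πp (into p p∈))) (unique uniq') }
    ; consec⁺ = λ { _ _ here _ → subst₂ (λ s t → Consec s t (a ∷ b ∷ r)) (≡.sym πp) (≡.sym πq) here
                  ; p' q' (there c) ne → there (consec⁺ p' q' c ne) }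
    ; consec⁻ = λ { _ _ here → p , q , here , πp , πq
                  ; b' c' (there c) →
                      let p' , q' , c' , e₁ , e₂ = consec⁻ b' c' c in p' , q' , there c' , e₁ , e₂ }
    ; longer = s≤s longer }
    where open Lift R

  lift-∷-same : ∀ {a r x p y} (R : Lift a r p y) → Adj G x p ≡ true → π x ≡ π p →
                (Unique (a ∷ r) → x ∉ (p ∷ Lift.tail R)) → Lift a r x y
  lift-∷-same {a} {r} {x} {p} R h πx≡πp fresh = record
    { tail = p ∷ tail ; walk = walk-∷ G h walk ; ends = ends
    ; into = λ { _ (here refl) → subst (_∈ (a ∷ r)) (≡.sym πx≡πp) (into p (here refl))
               ; z (there z∈) → into z z∈ }
    ; unique = λ uniq → unique-∷ (fresh uniq) (unique uniq)
    ; consec⁺ = λ { _ _ here ne → ⊥-elim (ne πx≡πp) ; p' q' (there c) ne → consec⁺ p' q' c ne }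
    ; consec⁻ = λ b c bc → let p' , q' , c' , e₁ , e₂ = consec⁻ b c bc in p' , q' , there c' , e₁ , e₂
    ; longer = ℕₚ.m≤n⇒m≤1+n longer }
    where open Lift R

  lift : ∀ a r x y → π x ≡ a → π y ≡ lastOf a r → IsWalk G' (a ∷ r) → Lift a r x y
  lift a []      x y πx πy w = lift-[] x y πx πy
  lift a (b ∷ r) x y πx πy w with π-adj⁻ (walk-head G' w)
  ... | _ , p , q , πp , πq , h = prepend (lift b r q y πq πy (walk-tail G' w))
    where
    prepend : Lift b r q y → Lift a (b ∷ r) x y
    prepend R with x ≟ p
    ... | yes x≡p = subst (λ t → Lift a (b ∷ r) t y) (≡.sym x≡p) (lift-∷-new h πp πq R)
    ... | no x≢p with π-identifies (trans πx (≡.sym πp))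
    ...   | inj₁ x≡p = ⊥-elim (x≢p x≡p)
    ...   | inj₂ h'  = lift-∷-same (lift-∷-new h πp πq R) h' (trans πx (≡.sym πp)) fresh
      where
      fresh : Unique (a ∷ b ∷ r) → x ∉ (p ∷ q ∷ Lift.tail R)
      fresh _    (here x≡p) = x≢p x≡p
      fresh uniq (there x∈) = Unique[x∷xs]⇒x∉xs uniq (subst (_∈ (b ∷ r)) πx (Lift.into R x x∈))

  contraction-acyclic : ¬ HasCycle G → ¬ HasCycle G'
  contraction-acyclic acyclic (a , as , len , uniq , w) with π-adj⁻ (w _ _ (consec-lastOf a as a))
  ... | _ , s , t , πs , πt , hst =
    acyclic (closed-path⇒cycle G t tail (walk , unique uniq) (ℕₚ.≤-trans len longer)
              (subst (λ z → Adj G z t ≡ true) (≡.sym ends) hst))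
    where open Lift (lift a as t s πt πs (walk-++⁻ˡ G' (a ∷ as) [ a ] w))

  contraction-connected : Connected G → Connected G'
  contraction-connected connected a b with π-surjective a | π-surjective b
  ... | x , refl | y , refl with connected x y
  ... | x' ∷ r , w , refl , last≡ =
    image x r , image-walk x r w , image-head x r ,
    trans (image-last x r) (cong (λ z → just (π z)) (just-injective (trans (≡.sym (last-∷ x r)) last≡)))

  contraction-nonempty : 1 ≤ n → 1 ≤ n'
  contraction-nonempty (s≤s _) = >-nonZero⁻¹ n' {{Finₚ.nonZeroIndex (π Fin.zero)}}

  contraction-tree : IsTree G → IsTree G'
  contraction-tree (nonempty , connected , acyclic) =
    contraction-nonempty nonempty , contraction-connected connected , contraction-acyclic acyclic

-- A contraction sequence yields a rank coloring

module _ {n : ℕ} (G : Graph n) where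

  two-edges⇒three-vertices : ∀ (e e' : Edge G) p → EdgeOn e p → EdgeOn e' p → ¬ SameEdge e e' →
                             ∃[ x₀ ] ∃[ x₁ ] ∃[ x₂ ] ∃[ r ] (p ≡ x₀ ∷ x₁ ∷ x₂ ∷ r)
  two-edges⇒three-vertices e e' (_ ∷ _ ∷ _ ∷ _) _ _ _ = _ , _ , _ , _ , refl
  two-edges⇒three-vertices e e' p@(_ ∷ _ ∷ []) on on' ¬same
    with on-joins G e p on | on-joins G e' p on'
  ... | _ , _ , here , j | _ , _ , here , j' = ⊥-elim (¬same (≡⇒sameEdge G (joins-unique G e e' j j')))
  ... | _ , _ , there (there ()) , _ | _
  ... | _ | _ , _ , there (there ()) , _
  two-edges⇒three-vertices e e' p@(_ ∷ []) on _ _ with on-joins G e p on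
  ... | _ , _ , there () , _
  two-edges⇒three-vertices e e' [] on _ _ with on-joins G e [] on
  ... | _ , _ , () , _

  path-unmatched-edge : ∀ {M} → IsMatching G M → ∀ {x₀ x₁ x₂ r} → IsPath G (x₀ ∷ x₁ ∷ x₂ ∷ r) →
                        ∃[ g ] (EdgeOn g (x₀ ∷ x₁ ∷ x₂ ∷ r) × M g ≡ false)
  path-unmatched-edge {M} matching {x₀} {x₁} {x₂} (w , (_ ∷ x₀≢x₂ ∷ _) ∷ _) =
    unmatched (w x₀ x₁ here) (w x₁ x₂ (there here))
    where
    unmatched : (h₀₁ : Adj G x₀ x₁ ≡ true) (h₁₂ : Adj G x₁ x₂ ≡ true) →
                ∃[ g ] (EdgeOn g (x₀ ∷ x₁ ∷ x₂ ∷ _) × M g ≡ false)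
    unmatched h₀₁ h₁₂ with M (toEdge G x₀ x₁ h₀₁) in m₀₁ | M (toEdge G x₁ x₂ h₁₂) in m₁₂
    ... | false | _     = _ , toEdge-on G _ here h₀₁ , m₀₁
    ... | true  | false = _ , toEdge-on G _ (there here) h₁₂ , m₁₂
    ... | true  | true  =
      ⊥-elim (x₀≢x₂ (samePair-shared j₀₁ (subst (λ e → Joins e x₁ x₂) (≡.sym same) j₁₂)))
      where
      j₀₁ = toEdge-joins G x₀ x₁ h₀₁
      j₁₂ = toEdge-joins G x₁ x₂ h₁₂
      same = matched-meet⇒≡ G matching m₀₁ m₁₂ j₀₁ j₁₂

module LiftedColoring {n n' k} {G : Graph n} {M : Edge G → Bool} {G' : Graph n'}
                       (acyclic : ¬ HasCycle G) (matching : IsMatching G M)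
                       (contraction : IsContraction G M G')
                       (c' : Edge G' → Fin k) (rank' : IsRankColoring G' k c') where

  open Contraction M G' contraction

  π-edge : ∀ e → M e ≡ false → Edge G'
  π-edge e ¬m = toEdge G' (π (u e)) (π (v e)) (π-adj (adj e) (unmatched⇒π-separates e ¬m))

  π-edge-joins : ∀ e (¬m : M e ≡ false) → Joins (π-edge e ¬m) (π (u e)) (π (v e))
  π-edge-joins e ¬m = toEdge-joins G' _ _ _

  π-edge-injective : ∀ {e e'} (¬m : M e ≡ false) (¬m' : M e' ≡ false) →
                     π-edge e ¬m ≡ π-edge e' ¬m' → e ≡ e'
  π-edge-injective {e} {e'} ¬m ¬m' eq =
    π-injective-on-edges acyclic e e' (unmatched⇒π-separates e ¬m)
      (samePair-trans (samePair-sym (π-edge-joins e ¬m))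
                      (subst (λ g → Joins g _ _) (≡.sym eq) (π-edge-joins e' ¬m')))

  π-edge-on : ∀ e (¬m : M e ≡ false) x r → EdgeOn e (x ∷ r) → EdgeOn (π-edge e ¬m) (image x r)
  π-edge-on e ¬m x r on with a , b , ab , j ← on-joins G e (x ∷ r) on =
    joins-on G' (π-edge e ¬m) (image x r) (samePair-trans (π-edge-joins e ¬m) (samePair-map π j))
      (consec-image x r ab (λ πa≡πb → unmatched⇒π-separates e ¬m (samePair-≡ (samePair-map π j) πa≡πb)))

  π-edge-onto-image : ∀ x r → IsWalk G (x ∷ r) → (g' : Edge G') → EdgeOn g' (image x r) →
                      ∃[ g ] (EdgeOn g (x ∷ r) × Σ (M g ≡ false) λ ¬m → π-edge g ¬m ≡ g')
  π-edge-onto-image x r w g' on'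
    with _ , _ , ab , j' ← on-joins G' g' (image x r) on'
    with x₁ , y₁ , c₁ , refl , refl , ne ← consec-image⁻ x r ab
    with g ← toEdge G x₁ y₁ (w _ _ c₁) in g≡ | M g in m
  ... | true  = ⊥-elim (ne (samePair-≡ (samePair-sym (samePair-map π jg)) (matched⇒π-collapses g m)))
    where jg = subst (λ t → Joins t x₁ y₁) g≡ (toEdge-joins G x₁ y₁ (w _ _ c₁))
  ... | false = g , subst (λ t → EdgeOn t (x ∷ r)) g≡ (toEdge-on G (x ∷ r) c₁ (w _ _ c₁)) , m ,
                joins-unique G' _ g' (samePair-trans (π-edge-joins g m) (samePair-map π jg)) j'
    where jg = subst (λ t → Joins t x₁ y₁) g≡ (toEdge-joins G x₁ y₁ (w _ _ c₁))

  colorBy : ∀ e b → M e ≡ b → Fin (suc k)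
  colorBy e true  _  = Fin.zero
  colorBy e false ¬m = Fin.suc (c' (π-edge e ¬m))

  -- Opaque, so that color-rank can split on M e.
  opaque
    color : Edge G → Fin (suc k)
    color e = colorBy e (M e) refl

    color≡ : ∀ e {b} (h : M e ≡ b) → color e ≡ colorBy e b h
    color≡ e refl = refl

  color-matched<unmatched : ∀ {e g} → M e ≡ true → M g ≡ false → toℕ (color e) < toℕ (color g)
  color-matched<unmatched {e} {g} m ¬m rewrite color≡ e m | color≡ g ¬m = s≤s z≤n

  color-unmatched : ∀ {e} (¬m : M e ≡ false) → toℕ (color e) ≡ suc (toℕ (c' (π-edge e ¬m)))
  color-unmatched {e} ¬m = cong toℕ (color≡ e ¬m)

  color-rank : IsRankColoring G (suc k) color
  color-rank e e' ¬same same-color p path on on' with M e in m | M e' in m'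
  ... | true  | true  with _ , _ , _ , _ , refl ← two-edges⇒three-vertices G e e' p on on' ¬same
                      with g , on-g , ¬mg ← path-unmatched-edge G matching path =
    g , on-g , color-matched<unmatched m ¬mg
  ... | true  | false with () ← trans (trans (≡.sym (color≡ e m)) same-color) (color≡ e' m')
  ... | false | true  with () ← trans (trans (≡.sym (color≡ e m)) same-color) (color≡ e' m')
  ... | false | false = unmatched-case p path on on'
    where
    unmatched-case : ∀ p → IsPath G p → EdgeOn e p → EdgeOn e' p →
                     ∃[ g ] (EdgeOn g p × toℕ (color e) < toℕ (color g))
    unmatched-case [] _ on _ with () ← on-joins G e [] on
    unmatched-case (x ∷ r) path on on'
      with g' , on-g' , lt ← rank' (π-edge e m) (π-edge e' m')
                                   (λ same → ¬same (≡⇒sameEdge G (π-edge-injective m m' (sameEdge⇒≡ G' same))))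
                                   (Finₚ.suc-injective (trans (trans (≡.sym (color≡ e m)) same-color) (color≡ e' m')))
                                   (image x r) (image-path acyclic x r path)
                                   (π-edge-on e m x r on) (π-edge-on e' m' x r on')
      with g , on-g , ¬mg , refl ← π-edge-onto-image x r (proj₁ path) g' on-g' =
      g , on-g , subst₂ _<_ (≡.sym (color-unmatched m)) (≡.sym (color-unmatched ¬mg)) (s≤s lt)

graph₁-edgeless : (G : Graph 1) → ¬ Edge G
graph₁-edgeless G (edge Fin.zero Fin.zero () _)

contracts⇒rankColorable : ∀ {n} {G : Graph n} {k} → ContractsIn G k → ¬ HasCycle G → RankColorable G k
contracts⇒rankColorable {G = G} (done refl) _ =
  (λ e → ⊥-elim (graph₁-edgeless G e)) , λ e → ⊥-elim (graph₁-edgeless G e)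
contracts⇒rankColorable (step M G' matching contraction rest) acyclic
  with c' , rank' ← contracts⇒rankColorable rest (Contraction.contraction-acyclic M G' contraction acyclic) =
  color , color-rank
  where open LiftedColoring acyclic matching contraction c' rank'

-- Every matching can be contracted

record FinQuotient (n : ℕ) (R : Fin n → Fin n → Set) : Set where
  field
    size       : ℕ
    classOf    : Fin n → Fin size
    surjective : ∀ a → ∃[ x ] (classOf x ≡ a)
    exact      : ∀ x y → classOf x ≡ classOf y → R x y
    sound      : ∀ x y → R x y → classOf x ≡ classOf y

module _ {n : ℕ} {R : Fin (suc n) → Fin (suc n) → Set} (equivalence : IsDecEquivalence R) where

  open IsDecEquivalence equivalence renaming (refl to R-refl; sym to R-sym; trans to R-trans; _≟_ to _R?_)

  restrict-isDecEquivalence : IsDecEquivalence (λ i j → R (Fin.suc i) (Fin.suc j))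
  restrict-isDecEquivalence = record
    { isEquivalence = record { refl = R-refl ; sym = R-sym ; trans = R-trans }
    ; _≟_ = λ i j → Fin.suc i R? Fin.suc j }

  module _ (Q : FinQuotient n (λ i j → R (Fin.suc i) (Fin.suc j))) where
    open FinQuotient Q

    quotient-∷-joined : ∀ j → R Fin.zero (Fin.suc j) → FinQuotient (suc n) R
    quotient-∷-joined j R0j = record
      { size       = size
      ; classOf    = λ { Fin.zero → classOf j ; (Fin.suc i) → classOf i }
      ; surjective = λ a → let x , eq = surjective a in Fin.suc x , eq
      ; exact      = λ { Fin.zero Fin.zero _ → R-refl
                       ; Fin.zero (Fin.suc i) eq → R-trans R0j (exact j i eq)
                       ; (Fin.suc i) Fin.zero eq → R-sym (R-trans R0j (exact j i (≡.sym eq)))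
                       ; (Fin.suc i) (Fin.suc i') eq → exact i i' eq }
      ; sound      = λ { Fin.zero Fin.zero _ → refl
                       ; Fin.zero (Fin.suc i) r → sound j i (R-trans (R-sym R0j) r)
                       ; (Fin.suc i) Fin.zero r → sound i j (R-trans r R0j)
                       ; (Fin.suc i) (Fin.suc i') r → sound i i' r } }

    quotient-∷-new : (∀ j → ¬ R Fin.zero (Fin.suc j)) → FinQuotient (suc n) R
    quotient-∷-new fresh = record
      { size       = suc size
      ; classOf    = λ { Fin.zero → Fin.zero ; (Fin.suc i) → Fin.suc (classOf i) }
      ; surjective = λ { Fin.zero → Fin.zero , refl
                       ; (Fin.suc a) → let x , eq = surjective a in Fin.suc x , cong Fin.suc eq }
      ; exact      = λ { Fin.zero Fin.zero _ → R-refl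
                       ; Fin.zero (Fin.suc _) ()
                       ; (Fin.suc _) Fin.zero ()
                       ; (Fin.suc i) (Fin.suc i') eq → exact i i' (Finₚ.suc-injective eq) }
      ; sound      = λ { Fin.zero Fin.zero _ → refl
                       ; Fin.zero (Fin.suc i) r → ⊥-elim (fresh i r)
                       ; (Fin.suc i) Fin.zero r → ⊥-elim (fresh i (R-sym r))
                       ; (Fin.suc i) (Fin.suc i') r → cong Fin.suc (sound i i' r) } }

finQuotient : ∀ n {R : Fin n → Fin n → Set} → IsDecEquivalence R → FinQuotient n R
finQuotient zero    _           = record
  { size = 0 ; classOf = λ () ; surjective = λ () ; exact = λ () ; sound = λ () }
finQuotient (suc n) equivalence
  with Q ← finQuotient n (restrict-isDecEquivalence equivalence)
     | Finₚ.any? (λ j → IsDecEquivalence._≟_ equivalence Fin.zero (Fin.suc j))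
... | yes (j , R0j) = quotient-∷-joined equivalence Q j R0j
... | no  ¬joined   = quotient-∷-new equivalence Q (λ j R0j → ¬joined (j , R0j))

does≡true⇒ : (d : Dec A) → does d ≡ true → A
does≡true⇒ (yes a) _ = a

module _ {n : ℕ} (G : Graph n) {M : Edge G → Bool} (matching : IsMatching G M) where

  Identified : Fin n → Fin n → Set
  Identified x y = x ≡ y ⊎ MatchedPair M x y

  matchedPair? : ∀ x y → Dec (MatchedPair M x y)
  matchedPair? x y with Adj G x y Boolₚ.≟ true
  ... | no ¬h = no λ (e , _ , j) → ¬h (joins-adj G e j)
  ... | yes h with M (toEdge G x y h) Boolₚ.≟ true
  ...   | yes m  = yes (toEdge G x y h , m , toEdge-joins G x y h)
  ...   | no ¬m  = no λ (e , m , j) →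
    ¬m (subst (λ t → M t ≡ true) (joins-unique G e _ j (toEdge-joins G x y h)) m)

  identified-isDecEquivalence : IsDecEquivalence Identified
  identified-isDecEquivalence = record
    { isEquivalence = record { refl = inj₁ refl ; sym = symmetric ; trans = transitive }
    ; _≟_ = λ x y → (x ≟ y) ⊎-dec matchedPair? x y }
    where
    symmetric : ∀ {x y} → Identified x y → Identified y x
    symmetric (inj₁ refl)        = inj₁ refl
    symmetric (inj₂ (e , m , j)) = inj₂ (e , m , samePair-trans j samePair-swap)

    transitive : ∀ {x y z} → Identified x y → Identified y z → Identified x z
    transitive (inj₁ refl) i = i
    transitive (inj₂ mp) (inj₁ refl) = inj₂ mp
    transitive (inj₂ (e , m , j)) (inj₂ (e' , m' , j')) =
      inj₁ (samePair-shared j (subst (λ t → Joins t _ _) (≡.sym (matched-meet⇒≡ G matching m m' j j')) j'))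

  open FinQuotient (finQuotient n identified-isDecEquivalence)

  JoinedClasses : Fin size → Fin size → Set
  JoinedClasses a b = a ≢ b × ∃[ x ] ∃[ y ] (classOf x ≡ a × classOf y ≡ b × Adj G x y ≡ true)

  joinedClasses? : ∀ a b → Dec (JoinedClasses a b)
  joinedClasses? a b =
    ¬? (a ≟ b) ×-dec Finₚ.any? λ x → Finₚ.any? λ y →
      (classOf x ≟ a) ×-dec (classOf y ≟ b) ×-dec (Adj G x y Boolₚ.≟ true)

  joinedClasses-sym : ∀ {a b} → JoinedClasses a b → JoinedClasses b a
  joinedClasses-sym (a≢b , x , y , ex , ey , h) = (λ b≡a → a≢b (≡.sym b≡a)) , y , x , ey , ex , adj-sym G h

  quotientGraph : Graph size
  quotientGraph = record
    { Adj    = λ a b → does (joinedClasses? a b)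
    ; sym    = λ a b → does-⇔ (mk⇔ joinedClasses-sym joinedClasses-sym) (joinedClasses? a b) (joinedClasses? b a)
    ; irrefl = λ a h → proj₁ (does≡true⇒ (joinedClasses? a a) h) refl }

  quotientGraph-contraction : IsContraction G M quotientGraph
  quotientGraph-contraction =
    classOf , surjective , (λ x y → mk⇔ (exact x y) (sound x y)) ,
    λ a b → mk⇔ (does≡true⇒ (joinedClasses? a b)) (dec-true (joinedClasses? a b))

-- Opaque: only the contraction property is needed, and unfolding the quotient is expensive.
opaque
  matching-contraction : ∀ {n} (G : Graph n) {M : Edge G → Bool} → IsMatching G M →
                         ∃[ n' ] Σ (Graph n') λ G' → IsContraction G M G'
  matching-contraction G matching = _ , quotientGraph G matching , quotientGraph-contraction G matching

-- A rank coloring of a tree yields a contraction sequence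

isZero : ∀ {k} → Fin (suc k) → Bool
isZero Fin.zero    = true
isZero (Fin.suc _) = false

isZero⇒≡zero : ∀ {k} (i : Fin (suc k)) → isZero i ≡ true → i ≡ Fin.zero
isZero⇒≡zero Fin.zero _ = refl

>⇒¬isZero : ∀ {k} (i j : Fin (suc k)) → toℕ i < toℕ j → isZero j ≡ false
>⇒¬isZero _ (Fin.suc _) _ = refl

predFin : ∀ {k} (i : Fin (suc k)) → isZero i ≡ false → Fin k
predFin (Fin.suc i) _ = i

suc-predFin : ∀ {k} (i : Fin (suc k)) h → suc (toℕ (predFin i h)) ≡ toℕ i
suc-predFin (Fin.suc i) _ = refl

module ColorZeroContraction {n k} {G : Graph n} (acyclic : ¬ HasCycle G)
                             (c : Edge G → Fin (suc k)) (rank : IsRankColoring G (suc k) c) where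

  M : Edge G → Bool
  M e = isZero (c e)

  -- A path x y z through two edges of color 0 has no edge of larger color.
  opaque
    matching : IsMatching G M
    matching = meet-free⇒matching G zeros-apart
      where
      zeros-apart : ∀ {e e' x y z} → M e ≡ true → M e' ≡ true →
                    Joins e x y → Joins e' y z → x ≢ z → ⊥
      zeros-apart {e} {e'} {x} {y} {z} m m' j j' x≢z =
        nothing-above (rank e e' ¬same same-color (x ∷ y ∷ z ∷ []) path
                        (joins-on G e _ j here) (joins-on G e' _ j' (there here)))
        where
        same-color : c e ≡ c e'
        same-color = trans (isZero⇒≡zero (c e) m) (≡.sym (isZero⇒≡zero (c e') m'))

        ¬same : ¬ SameEdge e e'
        ¬same same =
          x≢z (samePair-shared j (subst (λ t → Joins t y z) (≡.sym (sameEdge⇒≡ G {e} {e'} same)) j'))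

        path : IsPath G (x ∷ y ∷ z ∷ [])
        path = walk-∷ G (joins-adj G e j) (walk-∷ G (joins-adj G e' j') (walk-[-] G z)) ,
               (adj-≢ G (joins-adj G e j) ∷ x≢z ∷ []) ∷ (adj-≢ G (joins-adj G e' j') ∷ []) ∷ [] ∷ []

        nothing-above : ¬ (∃[ g ] (EdgeOn g (x ∷ y ∷ z ∷ []) × toℕ (c e) < toℕ (c g)))
        nothing-above (g , on-g , lt) with on-joins G g _ on-g
        ... | _ , _ , here , jg with refl ← joins-unique G g e jg j = ℕₚ.<-irrefl refl lt
        ... | _ , _ , there here , jg with refl ← joins-unique G g e' jg j' =
          ℕₚ.<-irrefl (cong toℕ same-color) lt
        ... | _ , _ , there (there (there ())) , _

  G' : Graph (proj₁ (matching-contraction G matching))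
  G' = proj₁ (proj₂ (matching-contraction G matching))

  contraction : IsContraction G M G'
  contraction = proj₂ (proj₂ (matching-contraction G matching))

  open Contraction M G' contraction

  MapsOnto : Edge G → Edge G' → Set
  MapsOnto g e' = SamePair (π (u g)) (π (v g)) (u e') (v e')

  mapsOnto-unique : ∀ {g e₁ e₂} → MapsOnto g e₁ → MapsOnto g e₂ → e₁ ≡ e₂
  mapsOnto-unique {e₁ = e₁} {e₂} m₁ m₂ = joins⇒≡ G' e₁ e₂ (samePair-trans (samePair-sym m₁) m₂)

  preimage : (e' : Edge G') → ∃[ g ] (MapsOnto g e' × M g ≡ false)
  preimage e' with u≢v , x , y , πx , πy , h ← π-adj⁻ (adj e') with M (toEdge G x y h) in m
  ... | true  = ⊥-elim (u≢v (trans (≡.sym πx) (trans πx≡πy πy)))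
    where πx≡πy = samePair-≡ (samePair-sym (samePair-map π (toEdge-joins G x y h))) (matched⇒π-collapses _ m)
  ... | false = toEdge G x y h , samePair-trans (samePair-map π (toEdge-joins G x y h)) (inj₁ (πx , πy)) , m

  preimage-unique : ∀ {g e'} → MapsOnto g e' → g ≡ proj₁ (preimage e')
  preimage-unique {g} {e'} maps =
    π-injective-on-edges acyclic g g' (λ eq → adj-≢ G' (adj e') (samePair-≡ (samePair-sym maps) eq))
      (samePair-trans maps (samePair-sym maps'))
    where
    g' = proj₁ (preimage e')
    maps' = proj₁ (proj₂ (preimage e'))

  c' : Edge G' → Fin k
  c' e' = predFin (c (proj₁ (preimage e'))) (proj₂ (proj₂ (preimage e')))

  c'-from-preimage : ∀ {g e'} → MapsOnto g e' → suc (toℕ (c' e')) ≡ toℕ (c g)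
  c'-from-preimage {g} {e'} maps =
    trans (suc-predFin _ (proj₂ (proj₂ (preimage e')))) (cong (toℕ ∘ c) (≡.sym (preimage-unique maps)))

  mapsOnto-distinct : ∀ {g₁ g₂ e₁ e₂} → MapsOnto g₁ e₁ → MapsOnto g₂ e₂ →
                      ¬ SameEdge e₁ e₂ → ¬ SameEdge g₁ g₂
  mapsOnto-distinct {g₁} {g₂} {e₁} {e₂} maps₁ maps₂ ¬same same =
    ¬same (≡⇒sameEdge G' (mapsOnto-unique {g₁} {e₁} {e₂} maps₁
      (subst (λ g → MapsOnto g e₂) (≡.sym (sameEdge⇒≡ G {g₁} {g₂} same)) maps₂)))

  mapsOnto-same-color : ∀ {g₁ g₂ e₁ e₂} → MapsOnto g₁ e₁ → MapsOnto g₂ e₂ →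
                        c' e₁ ≡ c' e₂ → c g₁ ≡ c g₂
  mapsOnto-same-color maps₁ maps₂ same = Finₚ.toℕ-injective
    (trans (≡.sym (c'-from-preimage maps₁)) (trans (cong (suc ∘ toℕ) same) (c'-from-preimage maps₂)))

  module _ {a r x₀ y₀} (w' : IsWalk G' (a ∷ r)) (L : Lift a r x₀ y₀) where
    open Lift L

    lift-edge : ∀ e' → EdgeOn e' (a ∷ r) → ∃[ g ] (EdgeOn g (x₀ ∷ tail) × MapsOnto g e')
    lift-edge e' on with _ , _ , ab , j ← on-joins G' e' (a ∷ r) on
                    with p , q , pq , refl , refl ← consec⁻ _ _ ab =
      toEdge G p q (walk p q pq) , toEdge-on G _ pq (walk p q pq) ,
      samePair-trans (samePair-map π (toEdge-joins G p q _)) (samePair-sym j)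

    project-edge : ∀ g → EdgeOn g (x₀ ∷ tail) → M g ≡ false →
                   ∃[ g' ] (EdgeOn g' (a ∷ r) × MapsOnto g g')
    project-edge g on ¬m with p , q , pq , j ← on-joins G g _ on =
      toEdge G' (π p) (π q) h , toEdge-on G' (a ∷ r) πpq h ,
      samePair-trans (samePair-map π j) (samePair-sym (toEdge-joins G' _ _ h))
      where
      πpq = consec⁺ p q pq λ eq → unmatched⇒π-separates g ¬m (samePair-≡ (samePair-map π j) eq)
      h = w' _ _ πpq

  rank' : IsRankColoring G' k c'
  rank' e₁ e₂ ¬same same-color [] _ on₁ _ with () ← on-joins G' e₁ [] on₁
  rank' e₁ e₂ ¬same same-color (a ∷ r) (w' , uniq') on₁ on₂
    with x₀ , πx₀ ← π-surjective a | y₀ , πy₀ ← π-surjective (lastOf a r)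
    with L ← lift a r x₀ y₀ πx₀ πy₀ w'
    with g₁ , on-g₁ , maps₁ ← lift-edge w' L e₁ on₁ | g₂ , on-g₂ , maps₂ ← lift-edge w' L e₂ on₂
    with g , on-g , lt ← rank g₁ g₂ (mapsOnto-distinct {g₁} {g₂} {e₁} {e₂} maps₁ maps₂ ¬same)
                              (mapsOnto-same-color maps₁ maps₂ same-color)
                              (x₀ ∷ Lift.tail L) (Lift.walk L , Lift.unique L uniq') on-g₁ on-g₂
    with g' , on-g' , maps ← project-edge w' L g on-g (>⇒¬isZero (c g₁) (c g) lt) =
    g' , on-g' , ℕₚ.≤-pred (subst₂ _<_ (≡.sym (c'-from-preimage maps₁)) (≡.sym (c'-from-preimage maps)) lt)

walk⇒edge : ∀ {n} (G : Graph n) {x y} p → IsWalk G p →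
            head p ≡ just x → last p ≡ just y → x ≢ y → Edge G
walk⇒edge G []          _ ()   _    _
walk⇒edge G (x ∷ [])    _ refl refl x≢y = ⊥-elim (x≢y refl)
walk⇒edge G (x ∷ z ∷ _) w _    _    _   = toEdge G x z (w x z here)

rankColorable⇒contracts : ∀ {n} (G : Graph n) k → IsTree G → RankColorable G k → ContractsIn G k
rankColorable⇒contracts {zero}        G zero    (() , _)             _
rankColorable⇒contracts {suc zero}    G zero    _                    _       = done refl
rankColorable⇒contracts {suc (suc _)} G zero    (_ , connected , _)  (c , _)
  with p , w , hd , lt ← connected Fin.zero (Fin.suc Fin.zero)
  with () ← c (walk⇒edge G p w hd lt (λ ()))
rankColorable⇒contracts G (suc k) tree@(_ , _ , acyclic) (c , rank) =
  step M G' matching contraction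
    (rankColorable⇒contracts G' k (Contraction.contraction-tree M G' contraction tree) (c' , rank'))
  where open ColorZeroContraction acyclic c rank

-- Deciding rank colorability

unique-lookup-injective : ∀ {xs : List A} → Unique xs → ∀ {i j} → lookup xs i ≡ lookup xs j → i ≡ j
unique-lookup-injective (_ ∷ _)    {Fin.zero}  {Fin.zero}  _  = refl
unique-lookup-injective (x∉ ∷ _)   {Fin.zero}  {Fin.suc j} eq = ⊥-elim (All.lookup x∉ (∈-lookup j) eq)
unique-lookup-injective (x∉ ∷ _)   {Fin.suc i} {Fin.zero}  eq = ⊥-elim (All.lookup x∉ (∈-lookup i) (≡.sym eq))
unique-lookup-injective (_ ∷ uniq) {Fin.suc i} {Fin.suc j} eq = cong Fin.suc (unique-lookup-injective uniq eq)

unique-length≤ : ∀ {n} (p : List (Fin n)) → Unique p → length p ≤ n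
unique-length≤ p uniq = Finₚ.injective⇒≤ (unique-lookup-injective uniq)

module _ {n : ℕ} where

  consec? : ∀ x y (p : List (Fin n)) → Dec (Consec x y p)
  consec? x y []          = no λ ()
  consec? x y (_ ∷ [])    = no λ { (there ()) }
  consec? x y (a ∷ b ∷ r) = map′ to from (((x ≟ a) ×-dec (y ≟ b)) ⊎-dec consec? x y (b ∷ r))
    where
    to : (x ≡ a × y ≡ b) ⊎ Consec x y (b ∷ r) → Consec x y (a ∷ b ∷ r)
    to (inj₁ (refl , refl)) = here
    to (inj₂ c)             = there c
    from : Consec x y (a ∷ b ∷ r) → (x ≡ a × y ≡ b) ⊎ Consec x y (b ∷ r)
    from here      = inj₁ (refl , refl)
    from (there c) = inj₂ c

  all-lists≤? : (Q : List (Fin n) → Set) → (∀ p → Dec (Q p)) →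
                ∀ m → Dec (∀ p → length p ≤ m → Q p)
  all-lists≤? Q Q? zero    = map′ (λ q → λ { [] _ → q }) (λ all → all [] z≤n) (Q? [])
  all-lists≤? Q Q? (suc m) =
    map′ (λ (q , all) → λ { [] _ → q ; (x ∷ p) (s≤s len) → all p len x })
         (λ all → all [] z≤n , λ p len x → all (x ∷ p) (s≤s len))
         (Q? [] ×-dec all-lists≤? (λ p → ∀ x → Q (x ∷ p)) (λ p → Finₚ.all? λ x → Q? (x ∷ p)) m)

module _ {n : ℕ} (G : Graph n) where

  walk? : ∀ p → Dec (IsWalk G p)
  walk? []          = yes λ _ _ ()
  walk? (x ∷ [])    = yes (walk-[-] G x)
  walk? (x ∷ y ∷ r) = map′ (λ (h , w) → walk-∷ G h w) (λ w → walk-head G w , walk-tail G w)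
                          ((Adj G x y Boolₚ.≟ true) ×-dec walk? (y ∷ r))

  path? : ∀ p → Dec (IsPath G p)
  path? p = walk? p ×-dec unique? p
    where open import Data.List.Relation.Unary.Unique.DecPropositional (_≟_ {n}) using (unique?)

  edgeOn? : ∀ (e : Edge G) p → Dec (EdgeOn e p)
  edgeOn? e p = consec? (u e) (v e) p ⊎-dec consec? (v e) (u e) p

  any-edge? : (P : Edge G → Set) → (∀ e → Dec (P e)) → Dec (∃ P)
  any-edge? P P? =
    map′ (λ (x , y , x<y , h , p) → edge x y x<y h , p) (λ (edge x y x<y h , p) → x , y , x<y , h , p)
         (Finₚ.any? λ x → Finₚ.any? λ y → edge? x y)
    where
    edge? : ∀ x y → Dec (∃[ x<y ] ∃[ h ] P (edge x y x<y h))
    edge? x y with toℕ x ℕₚ.<? toℕ y | Adj G x y Boolₚ.≟ true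
    ... | no ¬x<y | _     = no λ (x<y , _) → ¬x<y x<y
    ... | yes _   | no ¬h = no λ (_ , h , _) → ¬h h
    ... | yes x<y | yes h =
      map′ (λ p → x<y , h , p) (λ (_ , _ , p) → subst P (sameEdge⇒≡ G (refl , refl)) p) (P? (edge x y x<y h))

  all-edges? : (P : Edge G → Set) → (∀ e → Dec (P e)) → Dec (∀ e → P e)
  all-edges? P P? =
    map′ (λ ¬counter e → decidable-stable (P? e) λ ¬p → ¬counter (e , ¬p)) (λ all (e , ¬p) → ¬p (all e))
         (¬? (any-edge? (¬_ ∘ P) (¬? ∘ P?)))

  all-paths? : (R : List (Fin n) → Set) → (∀ p → Dec (R p)) → Dec (∀ p → IsPath G p → R p)
  all-paths? R R? =
    map′ (λ all p path → all p (unique-length≤ p (proj₂ path)) path) (λ all p _ → all p)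
         (all-lists≤? (λ p → IsPath G p → R p) (λ p → path? p →-dec R? p) n)

  rankColoring? : ∀ k (c : Edge G → Fin k) → Dec (IsRankColoring G k c)
  rankColoring? k c =
    all-edges? _ λ e → all-edges? _ λ e' →
      ¬? ((u e ≟ u e') ×-dec (v e ≟ v e')) →-dec (c e ≟ c e') →-dec
      all-paths? _ λ p → edgeOn? e p →-dec edgeOn? e' p →-dec
      any-edge? _ λ g → edgeOn? g p ×-dec (toℕ (c e) ℕₚ.<? toℕ (c g))

  rankColoring-cong : ∀ {k} {c c' : Edge G → Fin k} → (∀ e → c e ≡ c' e) →
                      IsRankColoring G k c → IsRankColoring G k c'
  rankColoring-cong c≗c' rank e e' ¬same same p path on on'
    with g , on-g , lt ← rank e e' ¬same (trans (c≗c' e) (trans same (≡.sym (c≗c' e')))) p path on on' =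
    g , on-g , subst₂ (λ s t → toℕ s < toℕ t) (c≗c' e) (c≗c' g) lt

  rankColorable-n² : RankColorable G (n * n)
  rankColorable-n² = (λ e → Fin.combine (u e) (v e)) ,
    λ e e' ¬same same → ⊥-elim (¬same (Finₚ.combine-injective (u e) (v e) (u e') (v e') same))

Searchable : (B : Set) → (B → B → Set) → Set₁
Searchable B _≈_ =
  ∀ (P : B → Set) → (∀ {a b} → a ≈ b → P a → P b) → (∀ b → Dec (P b)) → Dec (∃ P)

_∷ᶠ_ : ∀ {m} → B → (Fin m → B) → Fin (suc m) → B
(b ∷ᶠ g) Fin.zero    = b
(b ∷ᶠ g) (Fin.suc i) = g i

search-Fin : ∀ {k} → Searchable (Fin k) _≡_
search-Fin P _ P? = Finₚ.any? P?

search-→ : ∀ {_≈_ : B → B → Set} → (∀ {b} → b ≈ b) → Searchable B _≈_ →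
           ∀ m → Searchable (Fin m → B) (λ g h → ∀ i → g i ≈ h i)
search-→ ≈-refl search zero P resp P? with P? (λ ())
... | yes p = yes ((λ ()) , p)
... | no ¬p = no λ (g , p) → ¬p (resp (λ ()) p)
search-→ {B = B} {_≈_} ≈-refl search (suc m) P resp P? =
  map′ (λ (b , g , p) → b ∷ᶠ g , p)
       (λ (g , p) → g Fin.zero , (λ i → g (Fin.suc i)) ,
                    resp (λ { Fin.zero → ≈-refl ; (Fin.suc _) → ≈-refl }) p)
       (search (λ b → ∃ λ g → P (b ∷ᶠ g)) resp-head λ b →
         search-→ ≈-refl search m (λ g → P (b ∷ᶠ g)) (resp-tail b) (λ g → P? (b ∷ᶠ g)))
  where
  resp-head : ∀ {a b} → a ≈ b → (∃ λ g → P (a ∷ᶠ g)) → ∃ λ g → P (b ∷ᶠ g)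
  resp-head a≈b (g , p) = g , resp (λ { Fin.zero → a≈b ; (Fin.suc _) → ≈-refl }) p
  resp-tail : ∀ b {g h : Fin m → B} → (∀ i → g i ≈ h i) → P (b ∷ᶠ g) → P (b ∷ᶠ h)
  resp-tail b g≈h = resp λ { Fin.zero → ≈-refl ; (Fin.suc i) → g≈h i }

module _ {n : ℕ} (G : Graph n) where

  -- Any coloring is the restriction of a coloring of all ordered pairs of vertices.
  colorPairs : ∀ {k} → (Edge G → Fin (suc k)) → Fin n → Fin n → Fin (suc k)
  colorPairs c x y with toℕ x ℕₚ.<? toℕ y | Adj G x y Boolₚ.≟ true
  ... | yes x<y | yes h = c (edge x y x<y h)
  ... | _       | _     = Fin.zero

  colorPairs-edge : ∀ {k} (c : Edge G → Fin (suc k)) e → colorPairs c (u e) (v e) ≡ c e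
  colorPairs-edge c e with toℕ (u e) ℕₚ.<? toℕ (v e) | Adj G (u e) (v e) Boolₚ.≟ true
  ... | yes _    | yes _ = cong c (sameEdge⇒≡ G (refl , refl))
  ... | no ¬u<v  | _     = ⊥-elim (¬u<v (u<v e))
  ... | yes _    | no ¬h = ⊥-elim (¬h (adj e))

  rankColorable? : ∀ k → Dec (RankColorable G k)
  rankColorable? zero with any-edge? G (λ _ → ⊤) (λ _ → yes tt)
  ... | yes (e , _) = no λ (c , _) → Finₚ.¬Fin0 (c e)
  ... | no ¬edge    = yes ((λ e → ⊥-elim (¬edge (e , tt))) , λ e → ⊥-elim (¬edge (e , tt)))
  rankColorable? (suc k) =
    map′ (λ (g , rank) → (λ e → g (u e) (v e)) , rank)
         (λ (c , rank) → colorPairs c , rankColoring-cong G (λ e → ≡.sym (colorPairs-edge c e)) rank)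
         (search-→ (λ _ → refl) (search-→ refl search-Fin n) n
                   (λ g → IsRankColoring G (suc k) (λ e → g (u e) (v e)))
                   (λ g≈h → rankColoring-cong G (λ e → g≈h (u e) (v e)))
                   (λ g → rankColoring? G (suc k) _))

module _ {P : ℕ → Set} (P? : ∀ k → Dec (P k)) where

  search-below : ∀ N → (∀ k → k < N → ¬ P k) ⊎ ∃[ m ] (P m × ∀ k → k < m → ¬ P k)
  search-below zero = inj₁ λ _ ()
  search-below (suc N) with search-below N
  ... | inj₂ found = inj₂ found
  ... | inj₁ none with P? N
  ...   | yes pN = inj₂ (N , pN , none)
  ...   | no ¬pN = inj₁ λ k k<1+N → Sum.[ none k , (λ { refl → ¬pN }) ] (ℕₚ.m<1+n⇒m<n∨m≡n k<1+N)

  minimal : ∀ N → P N → ∃[ m ] (P m × ∀ k → P k → m ≤ k)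
  minimal N pN with search-below (suc N)
  ... | inj₁ none             = ⊥-elim (none N (ℕₚ.n<1+n N) pN)
  ... | inj₂ (m , pm , below) = m , pm , λ k pk → ℕₚ.≮⇒≥ λ k<m → below k k<m pk

mainTheorem4 : ∀ (n : ℕ) (U : Graph n) → IsTree U → ∃[ m ] (IsContr U m × IsErank U m)
mainTheorem4 n U tree@(_ , _ , acyclic)
  with m , colorable , least ← minimal (rankColorable? U) (n * n) (rankColorable-n² U) =
  m , (rankColorable⇒contracts U m tree colorable ,
       λ k contracts → least k (contracts⇒rankColorable contracts acyclic)) ,
      (colorable , least)
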